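{- If $n=2^k$ for some integer $k\ge 2$, then there is a $2$-MDS code in the Hamming graph $H(n,4)$ that can be partitioned into $2^k$ codes each having code distance at least $3$.
   Context: $H(n,4)$ is the Cartesian product of $n$ copies of the complete graph $K_4$, i.e. vertex set $\{0,1,2,3\}^n$ with two words adjacent iff they differ in exactly one coordinate; distance is Hamming distance. A code is a nonempty set of vertices; its code distance is the minimum distance between two distinct codewords (a one-element code imposes no constraint). A $2$-MDS code in $H(n,4)$ is an independent set of cardinality $4^{n-1}$. -}

module Defs where

open import Data.Nat using (ℕ; zero; suc; _+_; _≤_; _^_; _∸_)
open import Data.Fin using (Fin)
open import Data.Fin.Properties using (_≟_)
open import Data.Vec using (Vec; []; _∷_)
open import Data.List using (List; length)
open import Data.List.Membership.Propositional using (_∈_)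
open import Data.List.Relation.Unary.Unique.Propositional using (Unique)
open import Data.Product using (Σ; _×_; ∃-syntax)
open import Relation.Binary.PropositionalEquality using (_≡_)
open import Relation.Nullary using (¬_; yes; no)

Word : ℕ → Set
Word n = Vec (Fin 4) n

dist : ∀ {n} → Word n → Word n → ℕ
dist [] [] = 0
dist (a ∷ u) (b ∷ v) with a ≟ b
... | yes _ = dist u v
... | no  _ = suc (dist u v)

-- A code, represented as a duplicate-free list of words (so its cardinality is its length).
-- Nonemptiness is imposed separately where needed.

Independent : ∀ {n} → List (Word n) → Set
Independent {n} C = ∀ x y → x ∈ C → y ∈ C → ¬ (dist x y ≡ 1)

Is2MDS : ∀ {n} → List (Word n) → Set
Is2MDS {n} C = Unique C × Independent C × length C ≡ 4 ^ (n ∸ 1)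

CodeDistAtLeast : ∀ {n} → ℕ → (Word n → Set) → Set
CodeDistAtLeast {n} d S =
  (∃[ x ] S x) × (∀ x y → S x → S y → ¬ (x ≡ y) → d ≤ dist x y)

PartitionableInto : ∀ {n} → ℕ → ℕ → List (Word n) → Set
PartitionableInto {n} m d C =
  Σ (Word n → Fin m) λ cls →
    ∀ (i : Fin m) → CodeDistAtLeast d (λ x → x ∈ C × cls x ≡ i)

-- Identify the alphabet with 𝔽₂² and the 2ᵏ coordinates with 𝔽₂ᵏ. The parity code
-- {x : x₁ + ⋯ + xₙ = 0} is a 2-MDS code. Fix a complete mapping σ of 𝔽₂ᵏ (σ and id + σ are
-- both bijective; one exists for every k ≥ 2) and let coordinate h contribute the additive
-- map 𝔽₂² → 𝔽₂ᵏ sending the two basis vectors to h and σ h. The 2ᵏ classes are the fibres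
-- of the resulting syndrome map on the parity code. Two words of one class at distance 1
-- or 2 would differ by c eₕ or by c eₕ + c eₕ′ with c ≠ 0 and h ≠ h′ (equal parities force
-- the same letter c), and such a word has nonzero syndrome because h ↦ h, h ↦ σ h and
-- h ↦ h + σ h are injective.

module Submission where

open import Defs
open import Data.Bool.Base using (Bool; false; _xor_)
open import Data.Bool.Properties using (xor-assoc; xor-comm; xor-identityˡ; xor-same)
open import Data.Fin using (Fin; zero; suc; combine; finToFun; funToFin)
open import Data.Fin.Properties
  using (_≟_; 2↔Bool; *↔×; finToFun-funToFin; funToFin-finToFin; suc-injective)
open import Data.List using (List; length; map; allFin)
open import Data.List.Membership.Propositional using (_∈_)
open import Data.List.Membership.Propositional.Properties using (∈-map⁺; ∈-map⁻; ∈-allFin)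
open import Data.List.Properties using (length-map; length-tabulate)
open import Data.List.Relation.Unary.Unique.Propositional using (Unique)
import Data.List.Relation.Unary.Unique.Propositional.Properties as Unique
open import Data.Nat using (ℕ; zero; suc; _+_; _∸_; _≤_; _^_; z≤n; s≤s)
import Data.Nat.Properties as ℕ
open import Data.Product using (_×_; _,_; proj₁; proj₂; ∃₂; ∃-syntax)
open import Data.Vec using (Vec; []; _∷_; zipWith; replicate; lookup; tabulate; _[_]≔_)
open import Data.Vec.Properties
  using (zipWith-assoc; zipWith-comm; zipWith-identityˡ; ∷-injective;
         tabulate-cong; tabulate∘lookup; lookup∘tabulate)
open import Function.Base using (_∘_)
open import Function.Bundles using (_↔_; Inverse)
open import Function.Definitions using (Injective)
open import Relation.Binary.PropositionalEquality
  using (_≡_; _≢_; _≗_; refl; sym; trans; cong; cong₂; subst; module ≡-Reasoning)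
open import Relation.Nullary using (yes; no; contradiction)

-- Boolean groups

record BooleanGroup (A : Set) : Set where
  infixl 6 _∙_
  field
    _∙_           : A → A → A
    ε             : A
    ∙-assoc       : ∀ x y z → (x ∙ y) ∙ z ≡ x ∙ (y ∙ z)
    ∙-comm        : ∀ x y → x ∙ y ≡ y ∙ x
    ∙-identityˡ   : ∀ x → ε ∙ x ≡ x
    ∙-selfInverse : ∀ x → x ∙ x ≡ ε

open BooleanGroup {{...}}

module _ {A : Set} {{_ : BooleanGroup A}} where
  open ≡-Reasoning

  ∙-identityʳ : ∀ (x : A) → x ∙ ε ≡ x
  ∙-identityʳ x = trans (∙-comm x ε) (∙-identityˡ x)

  ∙-cancelʳ : ∀ {x y z w : A} → x ∙ z ≡ y ∙ w → z ≡ w → x ≡ y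
  ∙-cancelʳ {x} {y} {z} eq refl = begin
    x            ≡⟨ unwind x ⟩
    (x ∙ z) ∙ z  ≡⟨ cong (_∙ z) eq ⟩
    (y ∙ z) ∙ z  ≡⟨ unwind y ⟨
    y            ∎
    where
    unwind : ∀ v → v ≡ (v ∙ z) ∙ z
    unwind v = sym (trans (∙-assoc v z z) (trans (cong (v ∙_) (∙-selfInverse z)) (∙-identityʳ v)))

  ∙-cancelˡ : ∀ {x y z w : A} → z ∙ x ≡ w ∙ y → z ≡ w → x ≡ y
  ∙-cancelˡ {x} {y} {z} {w} eq = ∙-cancelʳ (trans (∙-comm x z) (trans eq (∙-comm w y)))

  ∙≡ε⇒≡ : ∀ {x y : A} → x ∙ y ≡ ε → x ≡ y
  ∙≡ε⇒≡ {y = y} eq = ∙-cancelʳ (trans eq (sym (∙-selfInverse y))) refl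

  ≡⇒∙≡ε : ∀ {x y : A} → x ≡ y → x ∙ y ≡ ε
  ≡⇒∙≡ε {x} refl = ∙-selfInverse x

  ∙-interchange : ∀ (a b c d : A) → (a ∙ b) ∙ (c ∙ d) ≡ (a ∙ c) ∙ (b ∙ d)
  ∙-interchange a b c d = begin
    (a ∙ b) ∙ (c ∙ d)  ≡⟨ ∙-assoc a b (c ∙ d) ⟩
    a ∙ (b ∙ (c ∙ d))  ≡⟨ cong (a ∙_) (∙-assoc b c d) ⟨
    a ∙ ((b ∙ c) ∙ d)  ≡⟨ cong (λ t → a ∙ (t ∙ d)) (∙-comm b c) ⟩
    a ∙ ((c ∙ b) ∙ d)  ≡⟨ cong (a ∙_) (∙-assoc c b d) ⟩
    a ∙ (c ∙ (b ∙ d))  ≡⟨ ∙-assoc a c (b ∙ d) ⟨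
    (a ∙ c) ∙ (b ∙ d)  ∎

module _ {A B : Set} {{_ : BooleanGroup A}} {{_ : BooleanGroup B}} where

  Additive : (A → B) → Set
  Additive f = ∀ x y → f (x ∙ y) ≡ f x ∙ f y

  additive⇒ε↦ε : ∀ {f} → Additive f → f ε ≡ ε
  additive⇒ε↦ε {f} f-additive =
    trans (cong f (sym (∙-identityˡ ε))) (trans (f-additive ε ε) (∙-selfInverse (f ε)))

transport : ∀ {A B : Set} → A ↔ B → {{BooleanGroup B}} → BooleanGroup A
transport A↔B = record
  { _∙_           = λ x y → from (to x ∙ to y)
  ; ε             = from ε
  ; ∙-assoc       = λ x y z → cong from (begin
      to (from (to x ∙ to y)) ∙ to z  ≡⟨ cong (_∙ to z) (strictlyInverseˡ _) ⟩
      (to x ∙ to y) ∙ to z            ≡⟨ ∙-assoc (to x) (to y) (to z) ⟩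
      to x ∙ (to y ∙ to z)            ≡⟨ cong (to x ∙_) (strictlyInverseˡ _) ⟨
      to x ∙ to (from (to y ∙ to z))  ∎)
  ; ∙-comm        = λ x y → cong from (∙-comm (to x) (to y))
  ; ∙-identityˡ   = λ x → trans (cong (λ e → from (e ∙ to x)) (strictlyInverseˡ ε))
                                (trans (cong from (∙-identityˡ (to x))) (strictlyInverseʳ x))
  ; ∙-selfInverse = λ x → cong from (∙-selfInverse (to x))
  }
  where open Inverse A↔B
        open ≡-Reasoning

instance
  Bool-booleanGroup : BooleanGroup Bool
  Bool-booleanGroup = record
    { _∙_ = _xor_ ; ε = false ; ∙-assoc = xor-assoc ; ∙-comm = xor-comm
    ; ∙-identityˡ = xor-identityˡ ; ∙-selfInverse = xor-same }

  ×-booleanGroup : {A B : Set} → {{BooleanGroup A}} → {{BooleanGroup B}} → BooleanGroup (A × B)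
  ×-booleanGroup = record
    { _∙_           = λ x y → (proj₁ x ∙ proj₁ y , proj₂ x ∙ proj₂ y)
    ; ε             = (ε , ε)
    ; ∙-assoc       = λ x y z → cong₂ _,_ (∙-assoc _ _ _) (∙-assoc _ _ _)
    ; ∙-comm        = λ x y → cong₂ _,_ (∙-comm _ _) (∙-comm _ _)
    ; ∙-identityˡ   = λ x → cong₂ _,_ (∙-identityˡ _) (∙-identityˡ _)
    ; ∙-selfInverse = λ x → cong₂ _,_ (∙-selfInverse _) (∙-selfInverse _)
    }

  Vec-booleanGroup : {A : Set} {n : ℕ} → {{BooleanGroup A}} → BooleanGroup (Vec A n)
  Vec-booleanGroup = record
    { _∙_           = zipWith _∙_
    ; ε             = replicate _ ε
    ; ∙-assoc       = zipWith-assoc ∙-assoc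
    ; ∙-comm        = zipWith-comm ∙-comm
    ; ∙-identityˡ   = zipWith-identityˡ ∙-identityˡ
    ; ∙-selfInverse = selfInverse
    }
    where
    selfInverse : ∀ {n} (v : Vec _ n) → zipWith _∙_ v v ≡ replicate n ε
    selfInverse []      = refl
    selfInverse (x ∷ v) = cong₂ _∷_ (∙-selfInverse x) (selfInverse v)

  Fin2-booleanGroup : BooleanGroup (Fin 2)
  Fin2-booleanGroup = transport 2↔Bool

  -- The alphabet of H(n,4) is the Klein four-group 𝔽₂², via Fin 4 ≅ Fin 2 × Fin 2.
  Fin4-booleanGroup : BooleanGroup (Fin 4)
  Fin4-booleanGroup = transport (*↔× {2} {2})

weight : ∀ {n} → Word n → ℕ
weight z = dist z ε

single : ∀ {n} → Fin n → Fin 4 → Word n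
single p c = ε [ p ]≔ c

dist≡weight∙ : ∀ {n} (x y : Word n) → dist x y ≡ weight (x ∙ y)
dist≡weight∙ [] [] = refl
dist≡weight∙ (a ∷ x) (b ∷ y) with a ≟ b | a ∙ b ≟ ε
... | yes _    | yes _     = dist≡weight∙ x y
... | no _     | no _      = cong suc (dist≡weight∙ x y)
... | yes refl | no a∙a≢ε  = contradiction (∙-selfInverse a) a∙a≢ε
... | no a≢b   | yes a∙b≡ε = contradiction (∙≡ε⇒≡ a∙b≡ε) a≢b

weight≡0⇒≡ε : ∀ {n} (z : Word n) → weight z ≡ 0 → z ≡ ε
weight≡0⇒≡ε []      _ = refl
weight≡0⇒≡ε (c ∷ z) w with c ≟ ε
... | yes refl = cong (ε ∷_) (weight≡0⇒≡ε z w)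

weight≡1⇒single : ∀ {n} (z : Word n) → weight z ≡ 1 →
  ∃₂ λ p c → c ≢ ε × z ≡ single p c
weight≡1⇒single (c ∷ z) w with c ≟ ε
... | yes refl = let p , d , d≢ε , z≡ = weight≡1⇒single z w in
  suc p , d , d≢ε , cong (ε ∷_) z≡
... | no c≢ε = zero , c , c≢ε , cong (c ∷_) (weight≡0⇒≡ε z (ℕ.suc-injective w))

weight≡2⇒single∙single : ∀ {n} (z : Word n) → weight z ≡ 2 →
  ∃₂ λ p q → ∃₂ λ c d → p ≢ q × c ≢ ε × z ≡ single p c ∙ single q d
weight≡2⇒single∙single (c ∷ z) w with c ≟ ε
... | yes refl = let p , q , c′ , d , p≢q , c′≢ε , z≡ = weight≡2⇒single∙single z w in
  suc p , suc q , c′ , d , p≢q ∘ suc-injective , c′≢ε , cong (ε ∷_) z≡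
... | no c≢ε = let q , d , _ , z≡ = weight≡1⇒single z (ℕ.suc-injective w) in
  zero , suc q , c , d , (λ ()) , c≢ε ,
  cong₂ _∷_ (sym (∙-identityʳ c)) (trans z≡ (sym (∙-identityˡ (single q d))))

-- Syndromes

syndrome : ∀ {G : Set} {{_ : BooleanGroup G}} {n} → (Fin n → Fin 4 → G) → Word n → G
syndrome φ []      = ε
syndrome φ (c ∷ x) = φ zero c ∙ syndrome (φ ∘ suc) x

module _ {G : Set} {{_ : BooleanGroup G}} where

  syndrome-∙ : ∀ {n} (φ : Fin n → Fin 4 → G) → (∀ p → Additive (φ p)) →
    ∀ x y → syndrome φ (x ∙ y) ≡ syndrome φ x ∙ syndrome φ y
  syndrome-∙ φ φ-additive []      []      = sym (∙-identityˡ ε)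
  syndrome-∙ φ φ-additive (c ∷ x) (d ∷ y) =
    trans (cong₂ _∙_ (φ-additive zero c d) (syndrome-∙ (φ ∘ suc) (φ-additive ∘ suc) x y))
          (∙-interchange _ _ _ _)

  syndrome-ε : ∀ {n} (φ : Fin n → Fin 4 → G) → (∀ p → Additive (φ p)) → syndrome φ ε ≡ ε
  syndrome-ε {zero}  φ φ-additive = refl
  syndrome-ε {suc n} φ φ-additive =
    trans (cong₂ _∙_ (additive⇒ε↦ε (φ-additive zero)) (syndrome-ε (φ ∘ suc) (φ-additive ∘ suc)))
          (∙-identityˡ ε)

  syndrome-single : ∀ {n} (φ : Fin n → Fin 4 → G) → (∀ p → Additive (φ p)) →
    ∀ p c → syndrome φ (single p c) ≡ φ p c
  syndrome-single φ φ-additive zero    c =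
    trans (cong (φ zero c ∙_) (syndrome-ε (φ ∘ suc) (φ-additive ∘ suc))) (∙-identityʳ _)
  syndrome-single φ φ-additive (suc p) c =
    trans (cong₂ _∙_ (additive⇒ε↦ε (φ-additive zero))
                     (syndrome-single (φ ∘ suc) (φ-additive ∘ suc) p c))
          (∙-identityˡ _)

syndrome-pair : ∀ {G H : Set} {{_ : BooleanGroup G}} {{_ : BooleanGroup H}} {n}
  (φ : Fin n → Fin 4 → G) (ψ : Fin n → Fin 4 → H) (x : Word n) →
  syndrome (λ p c → φ p c , ψ p c) x ≡ (syndrome φ x , syndrome ψ x)
syndrome-pair φ ψ []      = refl
syndrome-pair φ ψ (c ∷ x) = cong ((φ zero c , ψ zero c) ∙_) (syndrome-pair (φ ∘ suc) (ψ ∘ suc) x)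

module _ {G : Set} {{_ : BooleanGroup G}} {n} (φ : Fin n → Fin 4 → G) where

  NonzeroColumns : Set
  NonzeroColumns = ∀ p {c} → c ≢ ε → φ p c ≢ ε

  SeparatedColumns : Set
  SeparatedColumns = ∀ {p q c d} → c ≢ ε → φ p c ≡ φ q d → p ≡ q

module _ {G : Set} {{_ : BooleanGroup G}} {n}
         (φ : Fin n → Fin 4 → G) (φ-additive : ∀ p → Additive (φ p)) where

  private
    Φ = syndrome φ

    Φ-single : ∀ p c → Φ (single p c) ≡ φ p c
    Φ-single = syndrome-single φ φ-additive

    kernel : ∀ x y → Φ x ≡ Φ y → Φ (x ∙ y) ≡ ε
    kernel x y eq = trans (syndrome-∙ φ φ-additive x y) (≡⇒∙≡ε eq)

  syndrome≡⇒dist≢1 : NonzeroColumns φ → ∀ {x y} → syndrome φ x ≡ syndrome φ y → dist x y ≢ 1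
  syndrome≡⇒dist≢1 nonzero {x} {y} eq d≡1
    with p , c , c≢ε , x∙y≡ ← weight≡1⇒single (x ∙ y) (trans (sym (dist≡weight∙ x y)) d≡1) =
    nonzero p c≢ε (begin
      φ p c           ≡⟨ Φ-single p c ⟨
      Φ (single p c)  ≡⟨ cong Φ x∙y≡ ⟨
      Φ (x ∙ y)       ≡⟨ kernel x y eq ⟩
      ε               ∎)
    where open ≡-Reasoning

  syndrome≡⇒dist≢2 : SeparatedColumns φ → ∀ {x y} → syndrome φ x ≡ syndrome φ y → dist x y ≢ 2
  syndrome≡⇒dist≢2 separated {x} {y} eq d≡2
    with p , q , c , d , p≢q , c≢ε , x∙y≡ ←
         weight≡2⇒single∙single (x ∙ y) (trans (sym (dist≡weight∙ x y)) d≡2) =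
    p≢q (separated c≢ε (∙≡ε⇒≡ (begin
      φ p c ∙ φ q d                    ≡⟨ cong₂ _∙_ (Φ-single p c) (Φ-single q d) ⟨
      Φ (single p c) ∙ Φ (single q d)  ≡⟨ syndrome-∙ φ φ-additive (single p c) (single q d) ⟨
      Φ (single p c ∙ single q d)      ≡⟨ cong Φ x∙y≡ ⟨
      Φ (x ∙ y)                        ≡⟨ kernel x y eq ⟩
      ε                                ∎)))
    where open ≡-Reasoning

  syndrome≡⇒3≤dist : NonzeroColumns φ → SeparatedColumns φ →
    ∀ {x y} → syndrome φ x ≡ syndrome φ y → x ≢ y → 3 ≤ dist x y
  syndrome≡⇒3≤dist nonzero separated {x} {y} eq x≢y with dist x y in d≡
  ... | 0 = contradiction (∙≡ε⇒≡ (weight≡0⇒≡ε (x ∙ y) (trans (sym (dist≡weight∙ x y)) d≡))) x≢y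
  ... | 1 = contradiction d≡ (syndrome≡⇒dist≢1 nonzero {x} {y} eq)
  ... | 2 = contradiction d≡ (syndrome≡⇒dist≢2 separated {x} {y} eq)
  ... | suc (suc (suc _)) = s≤s (s≤s (s≤s z≤n))

module _ {A : Set} {{_ : BooleanGroup A}} where

  infixr 7 _·_

  _·_ : Fin 2 → A → A
  zero     · v = ε
  suc zero · v = v

  ·-distribʳ : ∀ (s t : Fin 2) (v : A) → (s ∙ t) · v ≡ s · v ∙ t · v
  ·-distribʳ zero       zero       v = sym (∙-identityˡ ε)
  ·-distribʳ zero       (suc zero) v = sym (∙-identityˡ v)
  ·-distribʳ (suc zero) zero       v = sym (∙-identityʳ v)
  ·-distribʳ (suc zero) (suc zero) v = sym (∙-selfInverse v)

  private
    bits : Fin 4 → Fin 2 × Fin 2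
    bits = Inverse.to (*↔× {2} {2})

    bits-∙ : ∀ c d → bits (c ∙ d) ≡ bits c ∙ bits d
    bits-∙ c d = Inverse.strictlyInverseˡ (*↔× {2} {2}) (bits c ∙ bits d)

  column : A → A → Fin 4 → A
  column h g c = proj₁ (bits c) · h ∙ proj₂ (bits c) · g

  column-additive : ∀ h g → Additive (column h g)
  column-additive h g c d = begin
    column h g (c ∙ d)                    ≡⟨ cong (λ st → proj₁ st · h ∙ proj₂ st · g) (bits-∙ c d) ⟩
    (s ∙ s′) · h ∙ (t ∙ t′) · g           ≡⟨ cong₂ _∙_ (·-distribʳ s s′ h) (·-distribʳ t t′ g) ⟩
    (s · h ∙ s′ · h) ∙ (t · g ∙ t′ · g)   ≡⟨ ∙-interchange (s · h) (s′ · h) (t · g) (t′ · g) ⟩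
    column h g c ∙ column h g d           ∎
    where
    open ≡-Reasoning
    s = proj₁ (bits c)
    t = proj₂ (bits c)
    s′ = proj₁ (bits d)
    t′ = proj₂ (bits d)

-- Complete mappings

record CompleteMapping (A : Set) {{_ : BooleanGroup A}} : Set where
  field
    σ              : A → A
    σ-injective    : Injective _≡_ _≡_ σ
    id∙σ-injective : Injective _≡_ _≡_ (λ x → x ∙ σ x)

  column-injective : ∀ {c} → c ≢ ε → Injective _≡_ _≡_ (λ h → column h (σ h) c)
  column-injective {zero}                   c≢ε = contradiction refl c≢ε
  column-injective {suc zero}               _   = λ eq → σ-injective (∙-cancelˡ eq refl)
  column-injective {suc (suc zero)}         _   = λ eq → ∙-cancelʳ eq refl
  column-injective {suc (suc (suc zero))}   _   = id∙σ-injective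

module _ {A : Set} {{_ : BooleanGroup A}} where
  open CompleteMapping

  nil-completeMapping : CompleteMapping (Vec A 0)
  nil-completeMapping = record
    { σ = λ x → x ; σ-injective = λ eq → eq ; id∙σ-injective = λ { {[]} {[]} _ → refl } }

  -- Multiplication by ω on 𝔽₄ ⊗ A, writing (a , b) for a + bω; 1 + ω = ω² is invertible too.
  ω-extend : ∀ {k} → CompleteMapping (Vec A k) → CompleteMapping (Vec A (2 + k))
  ω-extend {k} τ = record
    { σ = σ′ ; σ-injective = σ′-injective ; id∙σ-injective = id∙σ′-injective }
    where
    σ′ : Vec A (2 + k) → Vec A (2 + k)
    σ′ (a ∷ b ∷ x) = b ∷ a ∙ b ∷ σ τ x

    σ′-injective : Injective _≡_ _≡_ σ′
    σ′-injective {a ∷ b ∷ x} {a′ ∷ b′ ∷ x′} eq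
      with refl , eq′ ← ∷-injective eq
      with a∙b≡a′∙b , σx≡σx′ ← ∷-injective eq′ =
      cong₂ _∷_ (∙-cancelʳ a∙b≡a′∙b refl) (cong (b ∷_) (σ-injective τ σx≡σx′))

    id∙σ′-injective : Injective _≡_ _≡_ (λ x → x ∙ σ′ x)
    id∙σ′-injective {a ∷ b ∷ x} {a′ ∷ b′ ∷ x′} eq
      with a∙b≡a′∙b′ , eq′ ← ∷-injective eq
      with b∙[a∙b]≡b′∙[a′∙b′] , x≡x′ ← ∷-injective eq′
      with refl ← ∙-cancelʳ b∙[a∙b]≡b′∙[a′∙b′] a∙b≡a′∙b′ =
      cong₂ _∷_ (∙-cancelʳ a∙b≡a′∙b′ refl) (cong (b ∷_) (id∙σ-injective τ x≡x′))

  -- Multiplication by t on 𝔽₂[t]/(t³ + t + 1) ⊗ A, writing (a , b , c) for a + bt + ct².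
  𝔽₈-completeMapping : CompleteMapping (Vec A 3)
  𝔽₈-completeMapping = record
    { σ = σ′ ; σ-injective = σ′-injective ; id∙σ-injective = id∙σ′-injective }
    where
    σ′ : Vec A 3 → Vec A 3
    σ′ (a ∷ b ∷ c ∷ []) = c ∷ a ∙ c ∷ b ∷ []

    σ′-injective : Injective _≡_ _≡_ σ′
    σ′-injective {a ∷ b ∷ c ∷ []} {a′ ∷ b′ ∷ c′ ∷ []} eq
      with refl , eq′ ← ∷-injective eq
      with a∙c≡a′∙c , eq″ ← ∷-injective eq′
      with refl , _ ← ∷-injective eq″ =
      cong (_∷ b ∷ c ∷ []) (∙-cancelʳ a∙c≡a′∙c refl)

    id∙σ′-injective : Injective _≡_ _≡_ (λ x → x ∙ σ′ x)
    id∙σ′-injective {a ∷ b ∷ c ∷ []} {a′ ∷ b′ ∷ c′ ∷ []} eq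
      with a∙c≡a′∙c′ , eq′ ← ∷-injective eq
      with b∙[a∙c]≡b′∙[a′∙c′] , eq″ ← ∷-injective eq′
      with c∙b≡c′∙b′ , _ ← ∷-injective eq″
      with refl ← ∙-cancelʳ b∙[a∙c]≡b′∙[a′∙c′] a∙c≡a′∙c′
      with refl ← ∙-cancelʳ c∙b≡c′∙b′ refl =
      cong (_∷ b ∷ c ∷ []) (∙-cancelʳ a∙c≡a′∙c′ refl)

  vec-completeMapping : ∀ k → 2 ≤ k → CompleteMapping (Vec A k)
  vec-completeMapping 1 (s≤s ())
  vec-completeMapping 2 _ = ω-extend nil-completeMapping
  vec-completeMapping 3 _ = 𝔽₈-completeMapping
  vec-completeMapping (suc (suc k@(suc (suc _)))) _ =
    ω-extend (vec-completeMapping k (s≤s (s≤s z≤n)))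

toIndex : ∀ {b m} → Vec (Fin b) m → Fin (b ^ m)
toIndex v = funToFin (lookup v)

fromIndex : ∀ {b} m → Fin (b ^ m) → Vec (Fin b) m
fromIndex m i = tabulate (finToFun i)

fromIndex-toIndex : ∀ {b m} (v : Vec (Fin b) m) → fromIndex m (toIndex v) ≡ v
fromIndex-toIndex v = trans (tabulate-cong (finToFun-funToFin (lookup v))) (tabulate∘lookup v)

toIndex-fromIndex : ∀ {b} m (i : Fin (b ^ m)) → toIndex (fromIndex m i) ≡ i
toIndex-fromIndex {b} m i =
  trans (funToFin-cong (lookup∘tabulate (finToFun {b} {m} i))) (funToFin-finToFin {m} {b} i)
  where
  funToFin-cong : ∀ {m} {f g : Fin m → Fin b} → f ≗ g → funToFin f ≡ funToFin g
  funToFin-cong {zero}  _   = refl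
  funToFin-cong {suc m} f≗g = cong₂ combine (f≗g zero) (funToFin-cong (f≗g ∘ suc))

fromIndex-injective : ∀ {b} m → Injective _≡_ _≡_ (fromIndex {b} m)
fromIndex-injective m {i} {j} eq =
  trans (sym (toIndex-fromIndex m i)) (trans (cong toIndex eq) (toIndex-fromIndex m j))

toIndex-injective : ∀ {b m} → Injective _≡_ _≡_ (toIndex {b} {m})
toIndex-injective {m = m} {u} {v} eq =
  trans (sym (fromIndex-toIndex u)) (trans (cong (fromIndex m) eq) (fromIndex-toIndex v))

allWords : ∀ m → List (Word m)
allWords m = map (fromIndex m) (allFin (4 ^ m))

allWords-length : ∀ m → length (allWords m) ≡ 4 ^ m
allWords-length m =
  trans (length-map (fromIndex m) (allFin (4 ^ m))) (length-tabulate {n = 4 ^ m} (λ i → i))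

allWords-unique : ∀ m → Unique (allWords m)
allWords-unique m = Unique.map⁺ (fromIndex-injective m) (Unique.allFin⁺ (4 ^ m))

∈-allWords : ∀ {m} (x : Word m) → x ∈ allWords m
∈-allWords {m} x =
  subst (_∈ allWords m) (fromIndex-toIndex x) (∈-map⁺ (fromIndex m) (∈-allFin (toIndex x)))

-- The parity code

parity : ∀ {n} → Word n → Fin 4
parity = syndrome (λ _ c → c)

parity-∙ : ∀ {n} (x y : Word n) → parity (x ∙ y) ≡ parity x ∙ parity y
parity-∙ = syndrome-∙ (λ _ c → c) (λ _ _ _ → refl)

parity-single : ∀ {n} (p : Fin n) c → parity (single p c) ≡ c
parity-single = syndrome-single (λ _ c → c) (λ _ _ _ → refl)

parityCode : ∀ n → List (Word n)
parityCode zero    = allWords 0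
parityCode (suc m) = map (λ w → parity w ∷ w) (allWords m)

parityCode-length : ∀ n → length (parityCode n) ≡ 4 ^ (n ∸ 1)
parityCode-length zero    = allWords-length 0
parityCode-length (suc m) = trans (length-map _ (allWords m)) (allWords-length m)

parityCode-unique : ∀ n → Unique (parityCode n)
parityCode-unique zero    = allWords-unique 0
parityCode-unique (suc m) = Unique.map⁺ (proj₂ ∘ ∷-injective) (allWords-unique m)

∈parityCode⇒parity≡ε : ∀ {n} {x : Word n} → x ∈ parityCode n → parity x ≡ ε
∈parityCode⇒parity≡ε {zero}  {[]} _ = refl
∈parityCode⇒parity≡ε {suc m} x∈ with w , _ , refl ← ∈-map⁻ _ x∈ = ∙-selfInverse (parity w)

parity≡ε⇒∈parityCode : ∀ {n} (x : Word n) → parity x ≡ ε → x ∈ parityCode n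
parity≡ε⇒∈parityCode []      _ = ∈-allWords []
parity≡ε⇒∈parityCode (c ∷ w) c∙parity≡ε with refl ← ∙≡ε⇒≡ {x = c} {y = parity w} c∙parity≡ε =
  ∈-map⁺ _ (∈-allWords w)

parityCode-is2MDS : ∀ n → Is2MDS (parityCode n)
parityCode-is2MDS n = parityCode-unique n , independent , parityCode-length n
  where
  independent : Independent (parityCode n)
  independent x y x∈ y∈ = syndrome≡⇒dist≢1 (λ _ c → c) (λ _ _ _ → refl) (λ _ c≢ε → c≢ε) {x} {y}
    (trans (∈parityCode⇒parity≡ε x∈) (sym (∈parityCode⇒parity≡ε y∈)))

Bits : ℕ → Set
Bits k = Vec (Fin 2) k

module SyndromeClasses (k : ℕ) (τ : CompleteMapping (Bits k)) where
  open CompleteMapping τ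
  open ≡-Reasoning

  label : Fin (2 ^ k) → Bits k
  label = fromIndex k

  check : Fin (2 ^ k) → Fin 4 → Bits k
  check p = column (label p) (σ (label p))

  class : Word (2 ^ k) → Fin (2 ^ k)
  class x = toIndex (syndrome check x)

  extendedCheck : Fin (2 ^ k) → Fin 4 → Fin 4 × Bits k
  extendedCheck p c = c , check p c

  check-additive : ∀ p → Additive (check p)
  check-additive p = column-additive (label p) (σ (label p))

  extendedCheck-additive : ∀ p → Additive (extendedCheck p)
  extendedCheck-additive p c d = cong (c ∙ d ,_) (check-additive p c d)

  extendedCheck-nonzero : NonzeroColumns extendedCheck
  extendedCheck-nonzero p c≢ε = c≢ε ∘ cong proj₁

  extendedCheck-separated : SeparatedColumns extendedCheck
  extendedCheck-separated c≢ε eq with refl ← cong proj₁ eq =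
    fromIndex-injective k (column-injective c≢ε (cong proj₂ eq))

  sameClass⇒3≤dist : ∀ {x y} → x ∈ parityCode (2 ^ k) → y ∈ parityCode (2 ^ k) →
    class x ≡ class y → x ≢ y → 3 ≤ dist x y
  sameClass⇒3≤dist {x} {y} x∈ y∈ class≡ =
    syndrome≡⇒3≤dist extendedCheck extendedCheck-additive
      extendedCheck-nonzero extendedCheck-separated (begin
        syndrome extendedCheck x         ≡⟨ syndrome-pair (λ _ c → c) check x ⟩
        (parity x , syndrome check x)    ≡⟨ cong₂ _,_ parity≡ syndrome≡ ⟩
        (parity y , syndrome check y)    ≡⟨ syndrome-pair (λ _ c → c) check y ⟨
        syndrome extendedCheck y         ∎)
    where
    parity≡ : parity x ≡ parity y
    parity≡ = trans (∈parityCode⇒parity≡ε x∈) (sym (∈parityCode⇒parity≡ε y∈))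
    syndrome≡ : syndrome check x ≡ syndrome check y
    syndrome≡ = toIndex-injective class≡

  class-inhabited : ∀ i → ∃[ x ] (x ∈ parityCode (2 ^ k) × class x ≡ i)
  class-inhabited i =
    x ,
    parity≡ε⇒∈parityCode x parity≡ε ,
    trans (cong toIndex syndrome≡label) (toIndex-fromIndex k i)
    where
    c = suc (suc zero)
    o = toIndex (ε {Bits k})
    x = single i c ∙ single o c

    parity≡ε : parity x ≡ ε
    parity≡ε = begin
      parity (single i c ∙ single o c)           ≡⟨ parity-∙ (single i c) (single o c) ⟩
      parity (single i c) ∙ parity (single o c)  ≡⟨ cong₂ _∙_ (parity-single i c) (parity-single o c) ⟩
      c ∙ c                                      ≡⟨ ∙-selfInverse c ⟩
      ε                                          ∎

    Φ = syndrome check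

    syndrome≡label : Φ x ≡ label i
    syndrome≡label = begin
      Φ (single i c ∙ single o c)      ≡⟨ syndrome-∙ check check-additive (single i c) (single o c) ⟩
      Φ (single i c) ∙ Φ (single o c)  ≡⟨ cong₂ _∙_ (syndrome-single check check-additive i c)
                                                    (syndrome-single check check-additive o c) ⟩
      (label i ∙ ε) ∙ (label o ∙ ε)    ≡⟨ cong₂ _∙_ (∙-identityʳ (label i)) (∙-identityʳ (label o)) ⟩
      label i ∙ label o                ≡⟨ cong (label i ∙_) (fromIndex-toIndex ε) ⟩
      label i ∙ ε                      ≡⟨ ∙-identityʳ (label i) ⟩
      label i                          ∎

  partition : PartitionableInto (2 ^ k) 3 (parityCode (2 ^ k))
  partition = class , λ i → class-inhabited i ,
    λ x y (x∈ , x∼i) (y∈ , y∼i) → sameClass⇒3≤dist x∈ y∈ (trans x∼i (sym y∼i))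

proposition9 : ∀ (k n : ℕ) → 2 ≤ k → n ≡ 2 ^ k →
    ∃[ C ] (Is2MDS {n} C × PartitionableInto (2 ^ k) 3 C)
proposition9 k .(2 ^ k) 2≤k refl =
  parityCode (2 ^ k) ,
  parityCode-is2MDS (2 ^ k) ,
  SyndromeClasses.partition k (vec-completeMapping k 2≤k)
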